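{- Let $\mathcal M=(\mathcal C,D,\mathtt{app},\mathtt{lam},(\bar c_i)_{i=1}^n,\mathtt{fail},\mathtt{case})$ be a $\lambda_C$-model, $\Gamma=x_1,\dots,x_k$ a list of distinct variables, and $t_1,t_2$ terms such that $FV(t_1)\subseteq\Gamma$ and $t_1\to t_2$ (one reduction step). Then $[\![t_1]\!]_\Gamma=[\![t_2]\!]_\Gamma$.
   Context: The lambda calculus with constructors ($\lambda_C$). Fix constructors $\{c_1,\dots,c_n\}$ (constants, distinct from variables). Terms: $t,u::=x\mid tu\mid\lambda x.t\mid c\mid\{\theta\}\cdot t$, with case-bindings $\theta=\{d_1\mapsto u_1;\dots;d_k\mapsto u_k\}$ ($k\ge0$, $d_j$ pairwise distinct constructors), $\mathrm{dom}(\theta)=\{d_1,\dots,d_k\}$; terms up to $\alpha$-conversion. $\theta\circ\{d_1\mapsto t_1;\dots;d_k\mapsto t_k\}=\{d_1\mapsto\{\theta\}\cdot t_1;\dots;d_k\mapsto\{\theta\}\cdot t_k\}$. One-step reduction $\to$ is the contextual closure (also inside case-bindings) of: (AppLam) $(\lambda x.t)u\to t[x:=u]$; (LamApp) $\lambda x.t\,x\to t$ if $x\notin FV(t)$; (CaseCons) $\{\theta\}\cdot c\to t$ if $(c\mapsto t)\in\theta$; (CaseApp) $\{\theta\}\cdot(tu)\to(\{\theta\}\cdot t)u$; (CaseLam) $\{\theta\}\cdot\lambda x.t\to\lambda x.\{\theta\}\cdot t$ if $x\notin FV(\theta)$; (CaseCase) $\{\theta\}\cdot\{\phi\}\cdot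 t\to\{\theta\circ\phi\}\cdot t$. Categorical notation: diagrammatic composition $f;g$; pairing $\langle f,g\rangle$; projections $\pi^k_i$ ($\pi_i=\pi^2_i$); $!_A:A\to1$; $D^k$ $k$-fold product; exponential $B^A$, evaluation $\mathrm{ev}$, currying $\Lambda$; $\alpha$ canonical associativity isos $(A\times B)\times C\to A\times(B\times C)$. A $\lambda_C$-model is $(\mathcal C,D,\mathtt{app},\mathtt{lam},(\bar c_i)_{i=1}^n,\mathtt{fail},\mathtt{case})$ with $\mathcal C$ cartesian closed, $\bar c_i,\mathtt{fail}:1\to D$, $\mathtt{app}:D\to D^D$, $\mathtt{lam}:D^D\to D$, $\mathtt{case}:D^n\times D\to D$ such that, with $\widehat{\mathtt{case}}=\Lambda(\alpha;(\mathrm{id}_{D^n}\times\mathrm{ev});\mathtt{case})$ and $\mathtt{comp}=\langle(\mathrm{id}_{D^n}\times\pi^n_1);\mathtt{case},\dots,(\mathrm{id}_{D^n}\times\pi^n_n);\mathtt{case}\rangle$: (D1) $\mathtt{lam};\mathtt{app}=\mathrm{id}_{D^D}$, $\mathtt{app};\mathtt{lam}=\mathrm{id}_D$; (D2) for all $i$, $\langle\mathrm{id}_{D^n},!_{D^n}\rangle;(\mathrm{id}_{D^n}\times\bar c_i);\mathtt{case}=\pi^n_i$; (D3) $(\mathtt{case}\times\mathrm{id}_D);(\mathtt{app}\times\mathrm{id}_D);\mathrm{ev}=\alpha;(\mathrm{id}_{D^n}\times(\mathtt{app}\times\mathrm{id}_D));(\mathrm{id}_{D^n}\times\mathrm{ev});\mathtt{case}$;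 (D4) $\widehat{\mathtt{case}};\mathtt{lam}=(\mathrm{id}_{D^n}\times\mathtt{lam});\mathtt{case}$; (D5) $(\mathtt{comp}\times\mathrm{id}_D);\mathtt{case}=\alpha;(\mathrm{id}_{D^n}\times\mathtt{case});\mathtt{case}$; (D6) $(\mathrm{id}_{D^n}\times\mathtt{fail});\mathtt{case}=\pi_2;\mathtt{fail}$ on $D^n\times1$. Interpretation for $\Gamma=x_1,\dots,x_k$: $[\![x_i]\!]_\Gamma=\pi^k_i$; $[\![tu]\!]_\Gamma=\langle[\![t]\!]_\Gamma,[\![u]\!]_\Gamma\rangle;(\mathtt{app}\times\mathrm{id}_D);\mathrm{ev}$; $[\![\lambda x_{k+1}.t]\!]_\Gamma=\Lambda(f_t);\mathtt{lam}$ with $x_{k+1}\notin\Gamma$ and $f_t$ the iso $D^k\times D\cong D^{k+1}$ followed by $[\![t]\!]_{\Gamma,x_{k+1}}$; $[\![c_i]\!]_\Gamma=!_{D^k};\bar c_i$; $[\![\{\theta\}\cdot t]\!]_\Gamma=\langle[\![\theta]\!]_\Gamma,[\![t]\!]_\Gamma\rangle;\mathtt{case}$; $[\![\theta]\!]_\Gamma=\langle f_1,\dots,f_n\rangle$, $f_i=[\![u_i]\!]_\Gamma$ if $(c_i\mapsto u_i)\in\theta$, else $!_{D^k};\mathtt{fail}$. -}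

module Defs where

open import Level using (Level; _⊔_) renaming (suc to lsuc)
open import Data.Nat using (ℕ; zero; suc)
open import Data.Fin using (Fin; zero; suc)
open import Data.Maybe using (Maybe; just; nothing)
open import Relation.Binary.PropositionalEquality using (_≡_)
open import Relation.Binary.Structures using (IsEquivalence)
open import Relation.Nullary using (¬_)

-- Cartesian closed categories (hom-equality is a setoid equality).
-- Composition is diagrammatic: f ⨾ g  means "first f, then g".

record CCC (o ℓ e : Level) : Set (lsuc (o ⊔ ℓ ⊔ e)) where
  infixr 9 _⨾_
  infix  4 _≈_
  infixr 7 _×_
  field
    Obj  : Set o
    Hom  : Obj → Obj → Set ℓ
    _≈_  : ∀ {A B} → Hom A B → Hom A B → Set e
    ≈-equiv : ∀ {A B} → IsEquivalence (_≈_ {A} {B})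
    id   : ∀ {A} → Hom A A
    _⨾_  : ∀ {A B C} → Hom A B → Hom B C → Hom A C
    ⨾-cong : ∀ {A B C} {f f' : Hom A B} {g g' : Hom B C} →
             f ≈ f' → g ≈ g' → (f ⨾ g) ≈ (f' ⨾ g')
    idˡ  : ∀ {A B} (f : Hom A B) → (id ⨾ f) ≈ f
    idʳ  : ∀ {A B} (f : Hom A B) → (f ⨾ id) ≈ f
    assoc : ∀ {A B C E} (f : Hom A B) (g : Hom B C) (h : Hom C E) →
            ((f ⨾ g) ⨾ h) ≈ (f ⨾ (g ⨾ h))
    𝟙    : Obj
    !    : ∀ {A} → Hom A 𝟙
    !-unique : ∀ {A} (f : Hom A 𝟙) → f ≈ !
    _×_  : Obj → Obj → Obj
    π₁   : ∀ {A B} → Hom (A × B) A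
    π₂   : ∀ {A B} → Hom (A × B) B
    ⟨_,_⟩ : ∀ {C A B} → Hom C A → Hom C B → Hom C (A × B)
    π₁-β : ∀ {C A B} (f : Hom C A) (g : Hom C B) → (⟨ f , g ⟩ ⨾ π₁) ≈ f
    π₂-β : ∀ {C A B} (f : Hom C A) (g : Hom C B) → (⟨ f , g ⟩ ⨾ π₂) ≈ g
    ⟨⟩-unique : ∀ {C A B} {f : Hom C A} {g : Hom C B} (h : Hom C (A × B)) →
                (h ⨾ π₁) ≈ f → (h ⨾ π₂) ≈ g → h ≈ ⟨ f , g ⟩
    Exp  : Obj → Obj → Obj
    ev   : ∀ {A B} → Hom (Exp A B × A) B
    Λ    : ∀ {C A B} → Hom (C × A) B → Hom C (Exp A B)
    Λ-β  : ∀ {C A B} (f : Hom (C × A) B) →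
           (⟨ π₁ ⨾ Λ f , π₂ ⨾ id ⟩ ⨾ ev) ≈ f
    Λ-unique : ∀ {C A B} {f : Hom (C × A) B} (g : Hom C (Exp A B)) →
               (⟨ π₁ ⨾ g , π₂ ⨾ id ⟩ ⨾ ev) ≈ f → g ≈ Λ f

  _⊗_ : ∀ {A B A' B'} → Hom A A' → Hom B B' → Hom (A × B) (A' × B')
  f ⊗ g = ⟨ π₁ ⨾ f , π₂ ⨾ g ⟩

  α : ∀ {A B C} → Hom ((A × B) × C) (A × (B × C))
  α = ⟨ π₁ ⨾ π₁ , ⟨ π₁ ⨾ π₂ , π₂ ⟩ ⟩

  pow : Obj → ℕ → Obj
  pow D zero    = 𝟙
  pow D (suc k) = pow D k × D

  -- projections π^k_i (index zero = last component)
  proj : ∀ {D k} → Fin k → Hom (pow D k) D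
  proj zero    = π₂
  proj (suc i) = π₁ ⨾ proj i

  tuple : ∀ {A D} k → (Fin k → Hom A D) → Hom A (pow D k)
  tuple zero    fs = !
  tuple (suc k) fs = ⟨ tuple k (λ i → fs (suc i)) , fs zero ⟩

record Model {o ℓ e} (𝒞 : CCC o ℓ e) (n : ℕ) : Set (o ⊔ ℓ ⊔ e) where
  open CCC 𝒞
  field
    D    : Obj
    app  : Hom D (Exp D D)
    lam  : Hom (Exp D D) D
    cbar : Fin n → Hom 𝟙 D
    fail : Hom 𝟙 D
    case : Hom (pow D n × D) D

  caseHat : Hom (pow D n × Exp D D) (Exp D D)
  caseHat = Λ (α ⨾ (id ⊗ ev) ⨾ case)

  comp : Hom (pow D n × pow D n) (pow D n)
  comp = tuple n (λ i → (id ⊗ proj i) ⨾ case)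

  field
    D1a : (lam ⨾ app) ≈ id
    D1b : (app ⨾ lam) ≈ id
    D2  : ∀ (i : Fin n) → (⟨ id , ! ⟩ ⨾ (id ⊗ cbar i) ⨾ case) ≈ proj i
    D3  : ((case ⊗ id) ⨾ (app ⊗ id) ⨾ ev)
            ≈ (α ⨾ (id ⊗ (app ⊗ id)) ⨾ (id ⊗ ev) ⨾ case)
    D4  : (caseHat ⨾ lam) ≈ ((id ⊗ lam) ⨾ case)
    D5  : ((comp ⊗ id) ⨾ case) ≈ (α ⨾ (id ⊗ case) ⨾ case)
    D6  : ((id {pow D n} ⊗ fail) ⨾ case) ≈ (π₂ ⨾ fail)

-- λ_C terms, well-scoped de Bruijn syntax (α-conversion built in).
-- Term n k : terms over constructors Fin n with free variables among k.
-- cs θ t is {θ}·t.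

data Term (n : ℕ) : ℕ → Set where
  var  : ∀ {k} → Fin k → Term n k
  _·_  : ∀ {k} → Term n k → Term n k → Term n k
  ƛ    : ∀ {k} → Term n (suc k) → Term n k
  con  : ∀ {k} → Fin n → Term n k
  cs : ∀ {k} → (Fin n → Maybe (Term n k)) → Term n k → Term n k

CaseBinding : ℕ → ℕ → Set
CaseBinding n k = Fin n → Maybe (Term n k)

module _ {n : ℕ} where

  ext : ∀ {k m} → (Fin k → Fin m) → Fin (suc k) → Fin (suc m)
  ext ρ zero    = zero
  ext ρ (suc i) = suc (ρ i)

  rename  : ∀ {k m} → (Fin k → Fin m) → Term n k → Term n m
  renameM : ∀ {k m} → (Fin k → Fin m) → Maybe (Term n k) → Maybe (Term n m)
  rename ρ (var i)    = var (ρ i)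
  rename ρ (t · u)    = rename ρ t · rename ρ u
  rename ρ (ƛ t)      = ƛ (rename (ext ρ) t)
  rename ρ (con c)    = con c
  rename ρ (cs θ t) = cs (λ i → renameM ρ (θ i)) (rename ρ t)
  renameM ρ nothing  = nothing
  renameM ρ (just u) = just (rename ρ u)

  -- weakening of a case-binding (used for x ∉ FV(θ) in CaseLam)
  weakenθ : ∀ {k} → CaseBinding n k → CaseBinding n (suc k)
  weakenθ θ i = renameM suc (θ i)

  exts : ∀ {k m} → (Fin k → Term n m) → Fin (suc k) → Term n (suc m)
  exts σ zero    = var zero
  exts σ (suc i) = rename suc (σ i)

  subst  : ∀ {k m} → (Fin k → Term n m) → Term n k → Term n m
  substM : ∀ {k m} → (Fin k → Term n m) → Maybe (Term n k) → Maybe (Term n m)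
  subst σ (var i)    = σ i
  subst σ (t · u)    = subst σ t · subst σ u
  subst σ (ƛ t)      = ƛ (subst (exts σ) t)
  subst σ (con c)    = con c
  subst σ (cs θ t) = cs (λ i → substM σ (θ i)) (subst σ t)
  substM σ nothing  = nothing
  substM σ (just u) = just (subst σ u)

  _[_] : ∀ {k} → Term n (suc k) → Term n k → Term n k
  _[_] {k} t u = subst σ t
    where
    σ : Fin (suc k) → Term n k
    σ zero    = u
    σ (suc i) = var i

  _∘θ_ : ∀ {k} → CaseBinding n k → CaseBinding n k → CaseBinding n k
  (θ ∘θ φ) i with φ i
  ... | nothing = nothing
  ... | just t  = just (cs θ t)

  infix 3 _⟶_
  data _⟶_ {k : ℕ} : Term n k → Term n k → Set where
    AppLam   : ∀ (t : Term n (suc k)) u → (ƛ t · u) ⟶ (t [ u ])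
    LamApp   : ∀ (t : Term n k) → ƛ (rename suc t · var zero) ⟶ t
    CaseCons : ∀ θ c t → θ c ≡ just t → cs θ (con c) ⟶ t
    CaseApp  : ∀ θ t u → cs θ (t · u) ⟶ (cs θ t · u)
    CaseLam  : ∀ θ (t : Term n (suc k)) → cs θ (ƛ t) ⟶ ƛ (cs (weakenθ θ) t)
    CaseCase : ∀ θ φ t → cs θ (cs φ t) ⟶ cs (θ ∘θ φ) t
    appL  : ∀ {t t' u} → t ⟶ t' → (t · u) ⟶ (t' · u)
    appR  : ∀ {t u u'} → u ⟶ u' → (t · u) ⟶ (t · u')
    lamC  : ∀ {t t' : Term n (suc k)} → _⟶_ {suc k} t t' → ƛ t ⟶ ƛ t'
    caseT : ∀ {θ t t'} → t ⟶ t' → cs θ t ⟶ cs θ t'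
    caseθ : ∀ {θ θ' : CaseBinding n k} {t} (i : Fin n) {u u'} →
            θ i ≡ just u → θ' i ≡ just u' → u ⟶ u' →
            (∀ j → ¬ (j ≡ i) → θ' j ≡ θ j) →
            cs θ t ⟶ cs θ' t

module Interp {o ℓ e} {𝒞 : CCC o ℓ e} {n : ℕ} (M : Model 𝒞 n) where
  open CCC 𝒞
  open Model M

  ⟦_⟧  : ∀ {k} → Term n k → Hom (pow D k) D
  ⟦_⟧M : ∀ {k} → Maybe (Term n k) → Hom (pow D k) D
  ⟦ var i ⟧    = proj i
  ⟦ t · u ⟧    = ⟨ ⟦ t ⟧ , ⟦ u ⟧ ⟩ ⨾ (app ⊗ id) ⨾ ev
  ⟦ ƛ t ⟧      = Λ ⟦ t ⟧ ⨾ lam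
  ⟦ con c ⟧    = ! ⨾ cbar c
  ⟦ cs θ t ⟧ = ⟨ tuple n (λ i → ⟦ θ i ⟧M) , ⟦ t ⟧ ⟩ ⨾ case
  ⟦ nothing ⟧M = ! ⨾ fail
  ⟦ just u ⟧M  = ⟦ u ⟧

  ⟦_⟧θ : ∀ {k} → CaseBinding n k → Hom (pow D k) (pow D n)
  ⟦ θ ⟧θ = tuple n (λ i → ⟦ θ i ⟧M)

-- The interpretation commutes with substitution: ⟦ subst σ t ⟧ = ⟦ σ ⟧ₛ ⨾ ⟦ t ⟧, where ⟦ σ ⟧ₛ
-- tuples the interpretations of the terms substituted.  Hence β and η reduce to D1 together
-- with the β and η laws of the exponential, and every case rule is one of the axioms D2–D6
-- read at the generalized element given by the interpretations of the subterms (for CaseCase,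
-- D6 handles the constructors that φ leaves unbound).  The contextual rules hold because every
-- term former is interpreted by an operation that respects ≈.

module Submission where

open import Defs
open import Level using (Level)
open import Data.Nat using (ℕ; zero; suc)
open import Data.Fin using (Fin; zero; suc; _≟_)
open import Data.Maybe using (Maybe; just; nothing)
open import Relation.Binary.Bundles using (Setoid)
open import Relation.Binary.PropositionalEquality using (_≡_; refl; sym; cong)
open import Relation.Binary.Structures using (IsEquivalence)
open import Relation.Nullary using (¬_; yes; no)
import Relation.Binary.Reasoning.Setoid as SetoidReasoning

module CCCProperties {o ℓ e} (𝒞 : CCC o ℓ e) where
  open CCC 𝒞

  module ≈ {A B} = IsEquivalence (≈-equiv {A} {B})

  hom-setoid : Obj → Obj → Setoid ℓ e
  hom-setoid A B = record { isEquivalence = ≈-equiv {A} {B} }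

  module HomReasoning {A B} = SetoidReasoning (hom-setoid A B)
  open HomReasoning public

  ⨾-congˡ : ∀ {A B C} {f : Hom A B} {g g' : Hom B C} → g ≈ g' → f ⨾ g ≈ f ⨾ g'
  ⨾-congˡ = ⨾-cong ≈.refl

  ⨾-congʳ : ∀ {A B C} {f f' : Hom A B} {g : Hom B C} → f ≈ f' → f ⨾ g ≈ f' ⨾ g
  ⨾-congʳ p = ⨾-cong p ≈.refl

  sym-assoc : ∀ {A B C E} {f : Hom A B} {g : Hom B C} {h : Hom C E} → f ⨾ (g ⨾ h) ≈ (f ⨾ g) ⨾ h
  sym-assoc = ≈.sym (assoc _ _ _)

  pullˡ : ∀ {A B C E} {f : Hom A B} {g : Hom B C} {fg : Hom A C} {h : Hom C E} →
          f ⨾ g ≈ fg → f ⨾ (g ⨾ h) ≈ fg ⨾ h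
  pullˡ p = ≈.trans sym-assoc (⨾-congʳ p)

  cancelʳ : ∀ {A B C} {f : Hom A B} {g : Hom B C} {h : Hom C B} → g ⨾ h ≈ id → (f ⨾ g) ⨾ h ≈ f
  cancelʳ {f = f} p = ≈.trans (assoc _ _ _) (≈.trans (⨾-congˡ p) (idʳ f))

  ⟨⟩-cong : ∀ {C A B} {f f' : Hom C A} {g g' : Hom C B} → f ≈ f' → g ≈ g' → ⟨ f , g ⟩ ≈ ⟨ f' , g' ⟩
  ⟨⟩-cong {f = f} {g = g} p q = ⟨⟩-unique ⟨ f , g ⟩ (≈.trans (π₁-β f g) p) (≈.trans (π₂-β f g) q)

  ⟨⟩-precomp : ∀ {X C A B} (h : Hom X C) (f : Hom C A) (g : Hom C B) → h ⨾ ⟨ f , g ⟩ ≈ ⟨ h ⨾ f , h ⨾ g ⟩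
  ⟨⟩-precomp h f g = ⟨⟩-unique (h ⨾ ⟨ f , g ⟩) (≈.trans (assoc h ⟨ f , g ⟩ π₁) (⨾-congˡ (π₁-β f g)))
                                               (≈.trans (assoc h ⟨ f , g ⟩ π₂) (⨾-congˡ (π₂-β f g)))

  ⟨⟩-η : ∀ {A B} → ⟨ π₁ {A} {B} , π₂ ⟩ ≈ id
  ⟨⟩-η = ≈.sym (⟨⟩-unique id (idˡ π₁) (idˡ π₂))

  ⟨⟩-⊗ : ∀ {C A B A' B'} (f : Hom C A) (g : Hom C B) (h : Hom A A') (k : Hom B B') →
         ⟨ f , g ⟩ ⨾ (h ⊗ k) ≈ ⟨ f ⨾ h , g ⨾ k ⟩
  ⟨⟩-⊗ f g h k = ≈.trans (⟨⟩-precomp _ _ _) (⟨⟩-cong (pullˡ (π₁-β f g)) (pullˡ (π₂-β f g)))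

  ⟨⟩-first : ∀ {C A B A'} (f : Hom C A) (h : Hom A A') (g : Hom C B) →
             ⟨ f , g ⟩ ⨾ (h ⊗ id) ≈ ⟨ f ⨾ h , g ⟩
  ⟨⟩-first f h g = ≈.trans (⟨⟩-⊗ f g h id) (⟨⟩-cong ≈.refl (idʳ g))

  ⟨⟩-second : ∀ {C A B B'} (f : Hom C A) (g : Hom C B) (h : Hom B B') →
              ⟨ f , g ⟩ ⨾ (id ⊗ h) ≈ ⟨ f , g ⨾ h ⟩
  ⟨⟩-second f g h = ≈.trans (⟨⟩-⊗ f g id h) (⟨⟩-cong (idʳ f) ≈.refl)

  α-⟨⟩ : ∀ {X A B C} (a : Hom X A) (b : Hom X B) (c : Hom X C) → ⟨ ⟨ a , b ⟩ , c ⟩ ⨾ α ≈ ⟨ a , ⟨ b , c ⟩ ⟩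
  α-⟨⟩ a b c = ≈.trans (⟨⟩-precomp _ _ _)
    (⟨⟩-cong (≈.trans (pullˡ (π₁-β _ _)) (π₁-β a b))
             (≈.trans (⟨⟩-precomp _ _ _) (⟨⟩-cong (≈.trans (pullˡ (π₁-β _ _)) (π₂-β a b)) (π₂-β _ _))))

  Λ-cong : ∀ {C A B} {f f' : Hom (C × A) B} → f ≈ f' → Λ f ≈ Λ f'
  Λ-cong {f = f} p = Λ-unique (Λ f) (≈.trans (Λ-β f) p)

  Λ-η : ∀ {C A B} (g : Hom C (Exp A B)) → Λ ((g ⊗ id) ⨾ ev) ≈ g
  Λ-η g = ≈.sym (Λ-unique g ≈.refl)

  Λ-precomp : ∀ {C' C A B} (g : Hom C' C) (h : Hom (C × A) B) → g ⨾ Λ h ≈ Λ ((g ⊗ id) ⨾ h)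
  Λ-precomp g h = Λ-unique (g ⨾ Λ h) (begin
    ⟨ π₁ ⨾ (g ⨾ Λ h) , π₂ ⨾ id ⟩ ⨾ ev         ≈⟨ ⨾-congʳ (⟨⟩-cong sym-assoc ≈.refl) ⟩
    ⟨ (π₁ ⨾ g) ⨾ Λ h , π₂ ⨾ id ⟩ ⨾ ev         ≈⟨ ⨾-congʳ (⟨⟩-first (π₁ ⨾ g) (Λ h) (π₂ ⨾ id)) ⟨
    ((g ⊗ id) ⨾ (Λ h ⊗ id)) ⨾ ev               ≈⟨ assoc _ _ _ ⟩
    (g ⊗ id) ⨾ ((Λ h ⊗ id) ⨾ ev)               ≈⟨ ⨾-congˡ (Λ-β h) ⟩
    (g ⊗ id) ⨾ h                               ∎)

  Λ-ev : ∀ {C A B} (f : Hom (C × A) B) (b : Hom C A) → ⟨ Λ f , b ⟩ ⨾ ev ≈ ⟨ id , b ⟩ ⨾ f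
  Λ-ev f b = begin
    ⟨ Λ f , b ⟩ ⨾ ev                    ≈⟨ ⨾-congʳ (⟨⟩-cong (≈.sym (idˡ (Λ f))) ≈.refl) ⟩
    ⟨ id ⨾ Λ f , b ⟩ ⨾ ev               ≈⟨ ⨾-congʳ (⟨⟩-first id (Λ f) b) ⟨
    (⟨ id , b ⟩ ⨾ (Λ f ⊗ id)) ⨾ ev      ≈⟨ assoc _ _ _ ⟩
    ⟨ id , b ⟩ ⨾ ((Λ f ⊗ id) ⨾ ev)      ≈⟨ ⨾-congˡ (Λ-β f) ⟩
    ⟨ id , b ⟩ ⨾ f                       ∎

  tuple-cong : ∀ {A D} k {fs gs : Fin k → Hom A D} → (∀ i → fs i ≈ gs i) → tuple k fs ≈ tuple k gs
  tuple-cong zero    p = ≈.refl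
  tuple-cong (suc k) p = ⟨⟩-cong (tuple-cong k (λ i → p (suc i))) (p zero)

  tuple-proj : ∀ {A D} k (fs : Fin k → Hom A D) (i : Fin k) → tuple k fs ⨾ proj i ≈ fs i
  tuple-proj (suc k) fs zero    = π₂-β _ _
  tuple-proj (suc k) fs (suc i) = ≈.trans (pullˡ (π₁-β _ _)) (tuple-proj k _ i)

  tuple-precomp : ∀ {X A D} k (h : Hom X A) (fs : Fin k → Hom A D) → h ⨾ tuple k fs ≈ tuple k (λ i → h ⨾ fs i)
  tuple-precomp zero    h fs = !-unique _
  tuple-precomp (suc k) h fs = ≈.trans (⟨⟩-precomp _ _ _) (⟨⟩-cong (tuple-precomp k h _) ≈.refl)

  tuple-proj≈id : ∀ {D} k → tuple k (proj {D}) ≈ id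
  tuple-proj≈id zero    = ≈.sym (!-unique id)
  tuple-proj≈id (suc k) = ≈.trans (⟨⟩-cong π₁⨾tuple-proj≈π₁ ≈.refl) ⟨⟩-η
    where
    π₁⨾tuple-proj≈π₁ : tuple k (λ i → π₁ ⨾ proj i) ≈ π₁
    π₁⨾tuple-proj≈π₁ = ≈.trans (≈.sym (tuple-precomp k π₁ proj))
                               (≈.trans (⨾-congˡ (tuple-proj≈id k)) (idʳ π₁))

module ModelProperties {o ℓ e} {𝒞 : CCC o ℓ e} {n : ℕ} (M : Model 𝒞 n) where
  open CCC 𝒞
  open CCCProperties 𝒞
  open Model M

  app-lam : ∀ {X} (f : Hom X (Exp D D)) (g : Hom X D) →
            ⟨ f ⨾ lam , g ⟩ ⨾ (app ⊗ id) ⨾ ev ≈ ⟨ f , g ⟩ ⨾ ev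
  app-lam f g = begin
    ⟨ f ⨾ lam , g ⟩ ⨾ (app ⊗ id) ⨾ ev   ≈⟨ pullˡ (⟨⟩-⊗ _ _ _ _) ⟩
    ⟨ (f ⨾ lam) ⨾ app , g ⨾ id ⟩ ⨾ ev   ≈⟨ ⨾-congʳ (⟨⟩-cong (cancelʳ D1a) (idʳ g)) ⟩
    ⟨ f , g ⟩ ⨾ ev                       ∎

  lam-η : ∀ {X} (f : Hom X D) → Λ (⟨ π₁ ⨾ f , π₂ ⟩ ⨾ (app ⊗ id) ⨾ ev) ⨾ lam ≈ f
  lam-η f = begin
    Λ (⟨ π₁ ⨾ f , π₂ ⟩ ⨾ (app ⊗ id) ⨾ ev) ⨾ lam         ≈⟨ ⨾-congʳ (Λ-cong (pullˡ (⟨⟩-⊗ _ _ _ _))) ⟩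
    Λ (⟨ (π₁ ⨾ f) ⨾ app , π₂ ⨾ id ⟩ ⨾ ev) ⨾ lam         ≈⟨ ⨾-congʳ (Λ-cong (⨾-congʳ (⟨⟩-cong (assoc _ _ _) ≈.refl))) ⟩
    Λ (((f ⨾ app) ⊗ id) ⨾ ev) ⨾ lam                      ≈⟨ ⨾-congʳ (Λ-η (f ⨾ app)) ⟩
    (f ⨾ app) ⨾ lam                                      ≈⟨ cancelʳ D1b ⟩
    f                                                     ∎

  case-cbar : ∀ {X} (f : Hom X (pow D n)) (c : Fin n) → ⟨ f , ! ⨾ cbar c ⟩ ⨾ case ≈ f ⨾ proj c
  case-cbar f c = begin
    ⟨ f , ! ⨾ cbar c ⟩ ⨾ case                        ≈⟨ ⨾-congʳ (⟨⟩-second f ! (cbar c)) ⟨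
    (⟨ f , ! ⟩ ⨾ (id ⊗ cbar c)) ⨾ case              ≈⟨ ⨾-congʳ (⨾-congʳ f⨾⟨id,!⟩) ⟩
    ((f ⨾ ⟨ id , ! ⟩) ⨾ (id ⊗ cbar c)) ⨾ case       ≈⟨ ≈.trans (assoc _ _ _) (assoc _ _ _) ⟩
    f ⨾ ⟨ id , ! ⟩ ⨾ (id ⊗ cbar c) ⨾ case           ≈⟨ ⨾-congˡ (D2 c) ⟩
    f ⨾ proj c                                       ∎
    where
    f⨾⟨id,!⟩ : ⟨ f , ! ⟩ ≈ f ⨾ ⟨ id , ! ⟩
    f⨾⟨id,!⟩ = ≈.sym (≈.trans (⟨⟩-precomp f id !) (⟨⟩-cong (idʳ f) (!-unique _)))

  case-app : ∀ {X} (f : Hom X (pow D n)) (g h : Hom X D) →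
             ⟨ ⟨ f , g ⟩ ⨾ case , h ⟩ ⨾ (app ⊗ id) ⨾ ev ≈ ⟨ f , ⟨ g , h ⟩ ⨾ (app ⊗ id) ⨾ ev ⟩ ⨾ case
  case-app f g h = begin
    ⟨ ⟨ f , g ⟩ ⨾ case , h ⟩ ⨾ (app ⊗ id) ⨾ ev         ≈⟨ pullˡ (⟨⟩-first ⟨ f , g ⟩ case h) ⟨
    ⟨ ⟨ f , g ⟩ , h ⟩ ⨾ (case ⊗ id) ⨾ (app ⊗ id) ⨾ ev  ≈⟨ ⨾-congˡ D3 ⟩
    ⟨ ⟨ f , g ⟩ , h ⟩ ⨾ α ⨾ (id ⊗ (app ⊗ id)) ⨾ (id ⊗ ev) ⨾ case
                                                         ≈⟨ pullˡ (α-⟨⟩ f g h) ⟩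
    ⟨ f , ⟨ g , h ⟩ ⟩ ⨾ (id ⊗ (app ⊗ id)) ⨾ (id ⊗ ev) ⨾ case
                                                         ≈⟨ pullˡ (⟨⟩-second f _ (app ⊗ id)) ⟩
    ⟨ f , ⟨ g , h ⟩ ⨾ (app ⊗ id) ⟩ ⨾ (id ⊗ ev) ⨾ case   ≈⟨ pullˡ (⟨⟩-second f _ ev) ⟩
    ⟨ f , (⟨ g , h ⟩ ⨾ (app ⊗ id)) ⨾ ev ⟩ ⨾ case        ≈⟨ ⨾-congʳ (⟨⟩-cong ≈.refl (assoc _ _ _)) ⟩
    ⟨ f , ⟨ g , h ⟩ ⨾ (app ⊗ id) ⨾ ev ⟩ ⨾ case          ∎

  caseHat-Λ : ∀ {X} (f : Hom X (pow D n)) (h : Hom (X × D) D) →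
              ⟨ f , Λ h ⟩ ⨾ caseHat ≈ Λ (⟨ π₁ ⨾ f , h ⟩ ⨾ case)
  caseHat-Λ f h = ≈.trans (Λ-precomp _ _) (Λ-cong (begin
    ⟨ π₁ ⨾ ⟨ f , Λ h ⟩ , π₂ ⨾ id ⟩ ⨾ α ⨾ (id ⊗ ev) ⨾ case      ≈⟨ ⨾-congʳ (⟨⟩-cong (⟨⟩-precomp π₁ f (Λ h)) ≈.refl) ⟩
    ⟨ ⟨ π₁ ⨾ f , π₁ ⨾ Λ h ⟩ , π₂ ⨾ id ⟩ ⨾ α ⨾ (id ⊗ ev) ⨾ case  ≈⟨ pullˡ (α-⟨⟩ _ _ _) ⟩
    ⟨ π₁ ⨾ f , ⟨ π₁ ⨾ Λ h , π₂ ⨾ id ⟩ ⟩ ⨾ (id ⊗ ev) ⨾ case      ≈⟨ pullˡ (⟨⟩-second _ _ ev) ⟩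
    ⟨ π₁ ⨾ f , ⟨ π₁ ⨾ Λ h , π₂ ⨾ id ⟩ ⨾ ev ⟩ ⨾ case            ≈⟨ ⨾-congʳ (⟨⟩-cong ≈.refl (Λ-β h)) ⟩
    ⟨ π₁ ⨾ f , h ⟩ ⨾ case                                        ∎))

  case-lam : ∀ {X} (f : Hom X (pow D n)) (h : Hom (X × D) D) →
             ⟨ f , Λ h ⨾ lam ⟩ ⨾ case ≈ Λ (⟨ π₁ ⨾ f , h ⟩ ⨾ case) ⨾ lam
  case-lam f h = begin
    ⟨ f , Λ h ⨾ lam ⟩ ⨾ case              ≈⟨ pullˡ (⟨⟩-second f (Λ h) lam) ⟨
    ⟨ f , Λ h ⟩ ⨾ (id ⊗ lam) ⨾ case       ≈⟨ ⨾-congˡ D4 ⟨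
    ⟨ f , Λ h ⟩ ⨾ caseHat ⨾ lam           ≈⟨ pullˡ (caseHat-Λ f h) ⟩
    Λ (⟨ π₁ ⨾ f , h ⟩ ⨾ case) ⨾ lam       ∎

  case-case : ∀ {X} (f g : Hom X (pow D n)) (h : Hom X D) →
              ⟨ f , ⟨ g , h ⟩ ⨾ case ⟩ ⨾ case ≈ ⟨ ⟨ f , g ⟩ ⨾ comp , h ⟩ ⨾ case
  case-case f g h = begin
    ⟨ f , ⟨ g , h ⟩ ⨾ case ⟩ ⨾ case           ≈⟨ pullˡ (⟨⟩-second f _ case) ⟨
    ⟨ f , ⟨ g , h ⟩ ⟩ ⨾ (id ⊗ case) ⨾ case    ≈⟨ pullˡ (α-⟨⟩ f g h) ⟨
    ⟨ ⟨ f , g ⟩ , h ⟩ ⨾ α ⨾ (id ⊗ case) ⨾ case ≈⟨ ⨾-congˡ D5 ⟨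
    ⟨ ⟨ f , g ⟩ , h ⟩ ⨾ (comp ⊗ id) ⨾ case    ≈⟨ pullˡ (⟨⟩-first _ comp h) ⟩
    ⟨ ⟨ f , g ⟩ ⨾ comp , h ⟩ ⨾ case           ∎

  ⟨⟩⨾comp : ∀ {X} (f g : Hom X (pow D n)) → ⟨ f , g ⟩ ⨾ comp ≈ tuple n (λ i → ⟨ f , g ⨾ proj i ⟩ ⨾ case)
  ⟨⟩⨾comp f g = ≈.trans (tuple-precomp n _ _) (tuple-cong n (λ i → pullˡ (⟨⟩-second f g (proj i))))

  case-fail : ∀ {X} (f : Hom X (pow D n)) → ⟨ f , ! ⨾ fail ⟩ ⨾ case ≈ ! ⨾ fail
  case-fail f = begin
    ⟨ f , ! ⨾ fail ⟩ ⨾ case             ≈⟨ pullˡ (⟨⟩-second f ! fail) ⟨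
    ⟨ f , ! ⟩ ⨾ (id ⊗ fail) ⨾ case      ≈⟨ ⨾-congˡ D6 ⟩
    ⟨ f , ! ⟩ ⨾ π₂ ⨾ fail               ≈⟨ pullˡ (π₂-β f !) ⟩
    ! ⨾ fail                             ∎

module Soundness {o ℓ e} {𝒞 : CCC o ℓ e} {n : ℕ} (M : Model 𝒞 n) where
  open CCC 𝒞
  open CCCProperties 𝒞
  open Model M
  open ModelProperties M
  open Interp M

  ⟦_⟧ᵣ : ∀ {k m} → (Fin k → Fin m) → Hom (pow D m) (pow D k)
  ⟦_⟧ᵣ {k} ρ = tuple k (λ i → proj (ρ i))

  ⟦_⟧ₛ : ∀ {k m} → (Fin k → Term n m) → Hom (pow D m) (pow D k)
  ⟦_⟧ₛ {k} σ = tuple k (λ i → ⟦ σ i ⟧)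

  private
    precomp-app : ∀ {X Y Z W} (s : Hom X Y) {a : Hom Y Z} {b : Hom Y W} {a' b'} (q : Hom (Z × W) D) →
                  a' ≈ s ⨾ a → b' ≈ s ⨾ b → ⟨ a' , b' ⟩ ⨾ q ≈ s ⨾ ⟨ a , b ⟩ ⨾ q
    precomp-app s {a} {b} q p p' =
      ≈.trans (⨾-congʳ (≈.trans (⟨⟩-cong p p') (≈.sym (⟨⟩-precomp s a b)))) (assoc _ _ _)

    precomp-const : ∀ {X Y} (s : Hom X Y) (c : Hom 𝟙 D) → ! ⨾ c ≈ s ⨾ ! ⨾ c
    precomp-const s c = ≈.sym (pullˡ (!-unique _))

    precomp-lam : ∀ {X Y} (s : Hom X Y) {f : Hom (Y × D) D} {f' : Hom (X × D) D} →
                  f' ≈ (s ⊗ id) ⨾ f → Λ f' ⨾ lam ≈ s ⨾ Λ f ⨾ lam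
    precomp-lam s {f} p = ≈.trans (⨾-congʳ (≈.trans (Λ-cong p) (≈.sym (Λ-precomp s f)))) (assoc _ _ _)

  ⟦ext⟧ᵣ : ∀ {k m} (ρ : Fin k → Fin m) → ⟦ ext {n} ρ ⟧ᵣ ≈ ⟦ ρ ⟧ᵣ ⊗ id
  ⟦ext⟧ᵣ {k} ρ = ⟨⟩-cong (≈.sym (tuple-precomp k π₁ _)) (≈.sym (idʳ π₂))

  ⟦suc⟧ᵣ : ∀ k → ⟦ suc {k} ⟧ᵣ ≈ π₁
  ⟦suc⟧ᵣ k = ≈.trans (≈.sym (tuple-precomp k π₁ proj)) (≈.trans (⨾-congˡ (tuple-proj≈id k)) (idʳ π₁))

  ⟦rename⟧  : ∀ {k m} (ρ : Fin k → Fin m) (t : Term n k) → ⟦ rename ρ t ⟧ ≈ ⟦ ρ ⟧ᵣ ⨾ ⟦ t ⟧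
  ⟦rename⟧M : ∀ {k m} (ρ : Fin k → Fin m) (t : Maybe (Term n k)) → ⟦ renameM ρ t ⟧M ≈ ⟦ ρ ⟧ᵣ ⨾ ⟦ t ⟧M
  ⟦rename⟧ {k} ρ (var i) = ≈.sym (tuple-proj k _ i)
  ⟦rename⟧ ρ (t · u)     = precomp-app ⟦ ρ ⟧ᵣ _ (⟦rename⟧ ρ t) (⟦rename⟧ ρ u)
  ⟦rename⟧ ρ (ƛ t)       = precomp-lam ⟦ ρ ⟧ᵣ (≈.trans (⟦rename⟧ (ext {n} ρ) t) (⨾-congʳ (⟦ext⟧ᵣ ρ)))
  ⟦rename⟧ ρ (con c)     = precomp-const ⟦ ρ ⟧ᵣ (cbar c)
  ⟦rename⟧ ρ (cs θ t)    = precomp-app ⟦ ρ ⟧ᵣ case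
    (≈.trans (tuple-cong n (λ i → ⟦rename⟧M ρ (θ i))) (≈.sym (tuple-precomp n ⟦ ρ ⟧ᵣ _))) (⟦rename⟧ ρ t)
  ⟦rename⟧M ρ nothing  = precomp-const ⟦ ρ ⟧ᵣ fail
  ⟦rename⟧M ρ (just u) = ⟦rename⟧ ρ u

  ⟦weaken⟧ : ∀ {k} (t : Term n k) → ⟦ rename suc t ⟧ ≈ π₁ ⨾ ⟦ t ⟧
  ⟦weaken⟧ {k} t = ≈.trans (⟦rename⟧ suc t) (⨾-congʳ (⟦suc⟧ᵣ k))

  ⟦weakenθ⟧ : ∀ {k} (θ : CaseBinding n k) → ⟦ weakenθ θ ⟧θ ≈ π₁ ⨾ ⟦ θ ⟧θ
  ⟦weakenθ⟧ {k} θ = ≈.trans (tuple-cong n (λ i → ≈.trans (⟦rename⟧M suc (θ i)) (⨾-congʳ (⟦suc⟧ᵣ k))))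
                            (≈.sym (tuple-precomp n π₁ _))

  ⟦exts⟧ₛ : ∀ {k m} (σ : Fin k → Term n m) → ⟦ exts σ ⟧ₛ ≈ ⟦ σ ⟧ₛ ⊗ id
  ⟦exts⟧ₛ {k} σ = ⟨⟩-cong (≈.trans (tuple-cong k (λ i → ⟦weaken⟧ (σ i))) (≈.sym (tuple-precomp k π₁ _)))
                          (≈.sym (idʳ π₂))

  ⟦subst⟧  : ∀ {k m} (σ : Fin k → Term n m) (t : Term n k) → ⟦ subst σ t ⟧ ≈ ⟦ σ ⟧ₛ ⨾ ⟦ t ⟧
  ⟦subst⟧M : ∀ {k m} (σ : Fin k → Term n m) (t : Maybe (Term n k)) → ⟦ substM σ t ⟧M ≈ ⟦ σ ⟧ₛ ⨾ ⟦ t ⟧M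
  ⟦subst⟧ {k} σ (var i) = ≈.sym (tuple-proj k _ i)
  ⟦subst⟧ σ (t · u)     = precomp-app ⟦ σ ⟧ₛ _ (⟦subst⟧ σ t) (⟦subst⟧ σ u)
  ⟦subst⟧ σ (ƛ t)       = precomp-lam ⟦ σ ⟧ₛ (≈.trans (⟦subst⟧ (exts σ) t) (⨾-congʳ (⟦exts⟧ₛ σ)))
  ⟦subst⟧ σ (con c)     = precomp-const ⟦ σ ⟧ₛ (cbar c)
  ⟦subst⟧ σ (cs θ t)    = precomp-app ⟦ σ ⟧ₛ case
    (≈.trans (tuple-cong n (λ i → ⟦subst⟧M σ (θ i))) (≈.sym (tuple-precomp n ⟦ σ ⟧ₛ _))) (⟦subst⟧ σ t)
  ⟦subst⟧M σ nothing  = precomp-const ⟦ σ ⟧ₛ fail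
  ⟦subst⟧M σ (just u) = ⟦subst⟧ σ u

  -- The substitution behind t [ u ] is interpreted, by computation, as ⟨ tuple k proj , ⟦ u ⟧ ⟩.
  ⟦[]⟧ : ∀ {k} (t : Term n (suc k)) (u : Term n k) → ⟦ t [ u ] ⟧ ≈ ⟨ id , ⟦ u ⟧ ⟩ ⨾ ⟦ t ⟧
  ⟦[]⟧ {k} t u = ≈.trans (⟦subst⟧ _ t) (⨾-congʳ (⟨⟩-cong (tuple-proj≈id k) ≈.refl))

  ⟦∘θ⟧M : ∀ {k} (θ φ : CaseBinding n k) i → ⟦ (θ ∘θ φ) i ⟧M ≈ ⟨ ⟦ θ ⟧θ , ⟦ φ i ⟧M ⟩ ⨾ case
  ⟦∘θ⟧M θ φ i with φ i
  ... | just t  = ≈.refl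
  ... | nothing = ≈.sym (case-fail ⟦ θ ⟧θ)

  ⟦∘θ⟧ : ∀ {k} (θ φ : CaseBinding n k) → ⟦ θ ∘θ φ ⟧θ ≈ ⟨ ⟦ θ ⟧θ , ⟦ φ ⟧θ ⟩ ⨾ comp
  ⟦∘θ⟧ θ φ = ≈.sym (≈.trans (⟨⟩⨾comp _ _) (tuple-cong n λ i →
    ≈.trans (⨾-congʳ (⟨⟩-cong ≈.refl (tuple-proj n _ i))) (≈.sym (⟦∘θ⟧M θ φ i))))

  ⟦⟧θ-update : ∀ {k} (θ θ' : CaseBinding n k) (i : Fin n) {u u'} → θ i ≡ just u → θ' i ≡ just u' →
               ⟦ u ⟧ ≈ ⟦ u' ⟧ → (∀ j → ¬ j ≡ i → θ' j ≡ θ j) → ⟦ θ ⟧θ ≈ ⟦ θ' ⟧θ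
  ⟦⟧θ-update θ θ' i θi≡u θ'i≡u' u≈u' others = tuple-cong n at
    where
    at : ∀ j → ⟦ θ j ⟧M ≈ ⟦ θ' j ⟧M
    at j with j ≟ i
    ... | yes refl rewrite θi≡u | θ'i≡u' = u≈u'
    ... | no j≢i   = ≈.reflexive (cong ⟦_⟧M (sym (others j j≢i)))

  ⟶-sound : ∀ {k} {t₁ t₂ : Term n k} → t₁ ⟶ t₂ → ⟦ t₁ ⟧ ≈ ⟦ t₂ ⟧
  ⟶-sound (AppLam t u)         =
    ≈.trans (app-lam (Λ ⟦ t ⟧) ⟦ u ⟧) (≈.trans (Λ-ev ⟦ t ⟧ ⟦ u ⟧) (≈.sym (⟦[]⟧ t u)))
  ⟶-sound (LamApp t)           =
    ≈.trans (⨾-congʳ (Λ-cong (⨾-congʳ (⟨⟩-cong (⟦weaken⟧ t) ≈.refl)))) (lam-η ⟦ t ⟧)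
  ⟶-sound (CaseCons θ c t θc≡t) =
    ≈.trans (case-cbar ⟦ θ ⟧θ c) (≈.trans (tuple-proj n _ c) (≈.reflexive (cong ⟦_⟧M θc≡t)))
  ⟶-sound (CaseApp θ t u)      = ≈.sym (case-app ⟦ θ ⟧θ ⟦ t ⟧ ⟦ u ⟧)
  ⟶-sound (CaseLam θ t)        =
    ≈.trans (case-lam ⟦ θ ⟧θ ⟦ t ⟧) (⨾-congʳ (Λ-cong (⨾-congʳ (⟨⟩-cong (≈.sym (⟦weakenθ⟧ θ)) ≈.refl))))
  ⟶-sound (CaseCase θ φ t)     =
    ≈.trans (case-case ⟦ θ ⟧θ ⟦ φ ⟧θ ⟦ t ⟧) (⨾-congʳ (⟨⟩-cong (≈.sym (⟦∘θ⟧ θ φ)) ≈.refl))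
  ⟶-sound (appL r)             = ⨾-congʳ (⟨⟩-cong (⟶-sound r) ≈.refl)
  ⟶-sound (appR r)             = ⨾-congʳ (⟨⟩-cong ≈.refl (⟶-sound r))
  ⟶-sound (lamC r)             = ⨾-congʳ (Λ-cong (⟶-sound r))
  ⟶-sound (caseT r)            = ⨾-congʳ (⟨⟩-cong ≈.refl (⟶-sound r))
  ⟶-sound (caseθ {θ = θ} {θ' = θ'} i θi≡u θ'i≡u' r others) =
    ⨾-congʳ (⟨⟩-cong (⟦⟧θ-update θ θ' i θi≡u θ'i≡u' (⟶-sound r) others) ≈.refl)

proposition2 : ∀ {o ℓ e : Level} (𝒞 : CCC o ℓ e) (n : ℕ) (M : Model 𝒞 n)
                 (k : ℕ) (t₁ t₂ : Term n k) →
                 t₁ ⟶ t₂ →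
                 CCC._≈_ 𝒞 (Interp.⟦_⟧ M t₁) (Interp.⟦_⟧ M t₂)
proposition2 𝒞 n M k t₁ t₂ = Soundness.⟶-sound M
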